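{- Let $T$ be a tree. Then $Z_{\pm}(T)=Z(T)$.
   Context: Classical zero forcing on a graph $G$: start with a set $S$ of black vertices, others white; repeatedly, if a black vertex has exactly one white neighbour, color that neighbour black. $S$ is a zero forcing set if eventually all vertices are black; $Z(G)$ is the minimum size of a zero forcing set. $Z_{\pm}(G)$ denotes $Z_{\pm}(P_{\mathcal{Z}}(G))$, where $P_{\mathcal{Z}}(G)$ is the sign pattern with $P_{ii}=?$, $P_{ij}=-$ if $i\sim j$, $P_{ij}=0$ otherwise. Signed zero forcing game on a sign pattern $P$ (entries in $\{+,-,0,?\}$): each vertex is black or white; a white vertex may carry a marker $m(w)\in\{+,-\}$ ($m(w)=*$ if unmarked; markers vanish when a vertex is colored black). Initially a set $S$ is black, others white and unmarked. Write $\iota(+)=-$, $\iota(-)=+$, $s\cdot t=+$ if $s=t$ and $-$ otherwise. A move: let $u$ be black, or white with $P_{uu}\neq ?$; let $W$ be the set of white $w$ (possibly $w=u$) with $P_{uw}\in\{+,-\}$; $W_+=\{w\in W: m(w)=P_{uw}\}$, $W_-=\{w\in W: m(w)\neq *, m(w)\neq P_{uw}\}$, $W_*=\{w\in W:m(w)=*\}$. (a) If $W=\{w\}$, color $w$ black. (b) If $W_+=W$ or $W_-=W$, color all of $W$ black. (c) If $W_s\neq\emptyset$, $W_{\iota(s)}=\emptyset$, $W_*=\{w\}$, mark $w$ with $P_{uw}\cdot\iota(s)$. (d) If no white vertex is marked, any white vertex may be marked $+$. $S$ is a signed zero forcing set if some sequence of moves makes everything black; $Z_{\pm}(P)$ is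 the minimum size of such a set. -}

module Defs where

open import Data.Nat using (ℕ; _≤_)
open import Data.Bool using (Bool; true; false; T; if_then_else_)
open import Data.Fin using (Fin; _≟_)
open import Data.Fin.Subset using (Subset; _∈_; _∉_; ∣_∣)
open import Data.Vec using (lookup; _[_]≔_; tabulate)
open import Data.List using (List; []; _∷_; _++_; [_]; length)
open import Data.List.Relation.Unary.Linked using (Linked)
open import Data.List.Relation.Unary.Unique.Propositional using (Unique)
open import Data.Sum using (_⊎_)
open import Data.Product using (Σ; ∃; _×_; _,_)
open import Relation.Binary.PropositionalEquality using (_≡_; _≢_)
open import Relation.Binary.Construct.Closure.ReflexiveTransitive using (Star)
open import Relation.Nullary using (¬_)
open import Relation.Nullary.Decidable using (⌊_⌋)

record Graph (n : ℕ) : Set where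
  field
    adj    : Fin n → Fin n → Bool
    sym    : ∀ u v → adj u v ≡ adj v u
    irrefl : ∀ u → adj u u ≡ false
open Graph public

_∼[_]_ : ∀ {n} → Fin n → Graph n → Fin n → Set
u ∼[ G ] v = T (adj G u v)

data Walk {n} (G : Graph n) : Fin n → Fin n → Set where
  here : ∀ {u} → Walk G u u
  step : ∀ {u w v} → u ∼[ G ] w → Walk G w v → Walk G u v

Connected : ∀ {n} → Graph n → Set
Connected G = ∀ u v → Walk G u v

-- a cycle v ∷ vs : distinct vertices, at least 3 of them,
-- consecutive ones adjacent and the last adjacent to the first
IsCycle : ∀ {n} → Graph n → Fin n → List (Fin n) → Set
IsCycle G v vs =
  (2 ≤ length vs) × Unique (v ∷ vs) × Linked (λ a b → a ∼[ G ] b) (v ∷ vs ++ [ v ])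

Acyclic : ∀ {n} → Graph n → Set
Acyclic G = ∀ v vs → ¬ IsCycle G v vs

IsTree : ∀ {n} → Graph n → Set
IsTree G = Connected G × Acyclic G

-- Classical zero forcing (black = inside the subset)

data ZFStep {n} (G : Graph n) (B : Subset n) : Subset n → Set where
  force : ∀ u w → u ∈ B → w ∉ B → u ∼[ G ] w →
          (∀ x → u ∼[ G ] x → x ≢ w → x ∈ B) →
          ZFStep G B (B [ w ]≔ true)

AllBlack : ∀ {n} → Subset n → Set
AllBlack B = ∀ x → x ∈ B

IsZFSet : ∀ {n} → Graph n → Subset n → Set
IsZFSet G S = ∃ λ B → Star (ZFStep G) S B × AllBlack B

IsZ : ∀ {n} → Graph n → ℕ → Set
IsZ G k = (∃ λ S → IsZFSet G S × ∣ S ∣ ≡ k) × (∀ S → IsZFSet G S → k ≤ ∣ S ∣)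

data PM : Set where
  pos neg : PM

ι : PM → PM
ι pos = neg
ι neg = pos

_·_ : PM → PM → PM
pos · t = t
neg · t = ι t

data Entry : Set where
  sgn  : PM → Entry
  zero : Entry
  ques : Entry

SignPattern : ℕ → Set
SignPattern n = Fin n → Fin n → Entry

data Mark : Set where
  unmarked : Mark
  marked   : PM → Mark

data VState : Set where
  black : VState
  white : Mark → VState

State : ℕ → Set
State n = Fin n → VState

update : ∀ {n} → State n → Fin n → VState → State n
update st w c x = if ⌊ x ≟ w ⌋ then c else st x

Active : ∀ {n} → SignPattern n → State n → Fin n → Set
Active P st u = (st u ≡ black) ⊎ ((∃ λ m → st u ≡ white m) × P u u ≢ ques)

InW : ∀ {n} → SignPattern n → State n → Fin n → Fin n → Mark → PM → Set
InW P st u w m p = (st w ≡ white m) × (P u w ≡ sgn p)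

InWs : ∀ {n} → SignPattern n → State n → Fin n → PM → Fin n → Set
InWs P st u s w = ∃ λ p' → ∃ λ p → InW P st u w (marked p') p × (p' · p ≡ s)

InW* : ∀ {n} → SignPattern n → State n → Fin n → Fin n → Set
InW* P st u w = ∃ λ p → InW P st u w unmarked p

InWany : ∀ {n} → SignPattern n → State n → Fin n → Fin n → Set
InWany P st u w = ∃ λ m → ∃ λ p → InW P st u w m p

data SMove {n} (P : SignPattern n) (st : State n) : State n → Set where
  ruleA : ∀ u w → Active P st u →
          (∀ x → InWany P st u x → x ≡ w) → InWany P st u w →
          SMove P st (update st w black)
  ruleB : ∀ u s → Active P st u →
          (∀ x → InWany P st u x → InWs P st u s x) →
          (st' : State n) →
          (∀ x → InWany P st u x → st' x ≡ black) →
          (∀ x → ¬ InWany P st u x → st' x ≡ st x) →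
          SMove P st st'
  ruleC : ∀ u s w p → Active P st u →
          (∃ λ x → InWs P st u s x) →
          (∀ x → ¬ InWs P st u (ι s) x) →
          (∀ x → InW* P st u x → x ≡ w) →
          InW P st u w unmarked p →
          SMove P st (update st w (white (marked (p · ι s))))
  ruleD : ∀ w → (∀ x p → st x ≢ white (marked p)) →
          st w ≡ white unmarked →
          SMove P st (update st w (white (marked pos)))

initState : ∀ {n} → Subset n → State n
initState S x = if lookup S x then black else white unmarked

IsSZFSet : ∀ {n} → SignPattern n → Subset n → Set
IsSZFSet P S = ∃ λ st → Star (SMove P) (initState S) st × (∀ x → st x ≡ black)

IsZpm : ∀ {n} → SignPattern n → ℕ → Set
IsZpm P k = (∃ λ S → IsSZFSet P S × ∣ S ∣ ≡ k) × (∀ S → IsSZFSet P S → k ≤ ∣ S ∣)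

PZ : ∀ {n} → Graph n → SignPattern n
PZ G i j = if ⌊ i ≟ j ⌋ then ques else (if adj G i j then sgn neg else zero)

-- Z±(G) ≤ Z(G) for every graph, since a classical force u → w is move (a) of the
-- signed game.  Conversely, on a forest a signed game can be replayed classically
-- because of an invariant: the marked vertices are joined by walks through black or
-- marked vertices, no two marked vertices are adjacent, and no black vertex has two
-- neighbours with equal marks.  All off-diagonal signs of P_Z(G) are −, so W_s(u)
-- consists of the white neighbours of u marked ι s; by the invariant, move (b) thus
-- colours at most one vertex and is a classical force, and moves (c), (d) only mark.
-- A violation of the invariant after a move would close a cycle.
module Submission where

open import Defs
open import Data.Nat using (ℕ; _≤_; s≤s; z≤n)
open import Data.Nat.Properties using (≤-antisym)
open import Data.Bool using (Bool; true; false; T)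
open import Data.Empty using (⊥; ⊥-elim)
open import Data.Fin using (Fin; _≟_)
open import Data.Fin.Properties using (any?)
open import Data.Fin.Subset using (Subset; _∈_; _∉_)
open import Data.Vec using (lookup; _[_]≔_; tabulate)
open import Data.Vec.Properties
  using ([]=⇒lookup; lookup⇒[]=; lookup∘tabulate; tabulate-cong; lookup∘update; lookup∘update′)
open import Data.Vec.Relation.Binary.Pointwise.Extensional using (ext; Pointwise-≡⇒≡)
open import Data.List using (List; []; _∷_; _++_; [_]; length)
open import Data.List.Membership.Propositional using () renaming (_∈_ to _∈ₗ_)
open import Data.List.Relation.Unary.All using (All; []; _∷_)
open import Data.List.Relation.Unary.All.Properties using (¬Any⇒All¬)
open import Data.List.Relation.Unary.AllPairs using ([]; _∷_)
open import Data.List.Relation.Unary.Any using (here; there)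
open import Data.List.Relation.Unary.Linked using (Linked; [-]; _∷_)
open import Data.List.Relation.Unary.Unique.Propositional using (Unique)
open import Data.Product using (Σ; ∃; _×_; _,_; proj₁; proj₂)
open import Data.Sum using (_⊎_; inj₁; inj₂)
open import Function using (_∘_)
open import Relation.Binary.PropositionalEquality
  using (_≡_; _≢_; _≗_; refl; trans; cong; subst) renaming (sym to ≡-sym)
open import Relation.Binary.Construct.Closure.ReflexiveTransitive using (Star; ε; _◅_; _◅◅_)
open import Relation.Binary.Construct.Closure.ReflexiveTransitive.Properties using (reflexive)
open import Relation.Nullary using (¬_; Dec; yes; no)

·neg-injective : ∀ {p q s} → p · neg ≡ s → q · neg ≡ s → p ≡ q
·neg-injective {pos} {pos} _ _ = refl
·neg-injective {neg} {neg} _ _ = refl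
·neg-injective {pos} {neg} refl ()
·neg-injective {neg} {pos} refl ()

ι-·neg : ∀ {p s} → p · neg ≡ s → ι p · neg ≡ ι s × neg · ι s ≡ ι p
ι-·neg {pos} refl = refl , refl
ι-·neg {neg} refl = refl , refl

module _ {n : ℕ} where

  update-≡ : ∀ (st : State n) w c → update st w c w ≡ c
  update-≡ st w c with w ≟ w
  ... | yes _ = refl
  ... | no w≢w = ⊥-elim (w≢w refl)

  Marked : State n → Fin n → PM → Set
  Marked st x p = st x ≡ white (marked p)

  Fresh : State n → Fin n → Set
  Fresh st x = st x ≡ white unmarked

  Touched : State n → Fin n → Set
  Touched st x = ¬ Fresh st x

  marked-after-marking : ∀ {st w p y q} → Marked (update st w (white (marked p))) y q →
                         (y ≡ w × q ≡ p) ⊎ (y ≢ w × Marked st y q)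
  marked-after-marking {w = w} {y = y} my with y ≟ w
  marked-after-marking refl | yes refl = inj₁ (refl , refl)
  ... | no y≢w = inj₂ (y≢w , my)

  marked-after-blackening : ∀ {st w y q} → Marked (update st w black) y q → Marked st y q
  marked-after-blackening {w = w} {y = y} my with y ≟ w
  marked-after-blackening () | yes _
  ... | no _ = my

  black-touched : ∀ {st x} → st x ≡ black → Touched st x
  black-touched b f with trans (≡-sym b) f
  ... | ()

  marked-touched : ∀ {st x p} → Marked st x p → Touched st x
  marked-touched m f with trans (≡-sym m) f
  ... | ()

  fresh-avoids-touched : ∀ {st w x} → Fresh st w → Touched st x → w ≢ x
  fresh-avoids-touched fw tx refl = tx fw

  touched-update : ∀ st w {c} → c ≢ white unmarked → ∀ {y} → Touched st y → Touched (update st w c) y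
  touched-update st w c-touched {y} y-touched with y ≟ w
  ... | yes _ = c-touched
  ... | no _ = y-touched

  W? : ∀ (P : SignPattern n) st u x → Dec (InWany P st u x)
  W? P st u x with st x | P u x
  ... | black   | _     = no λ { (_ , _ , () , _) }
  ... | white m | sgn p = yes (m , p , refl , refl)
  ... | white _ | zero  = no λ { (_ , _ , _ , ()) }
  ... | white _ | ques  = no λ { (_ , _ , _ , ()) }

  isBlack : VState → Bool
  isBlack black = true
  isBlack (white _) = false

  blackSet : State n → Subset n
  blackSet st = tabulate (isBlack ∘ st)

  lookup-blackSet : ∀ st x → lookup (blackSet st) x ≡ isBlack (st x)
  lookup-blackSet st = lookup∘tabulate (isBlack ∘ st)

  black⇒∈blackSet : ∀ {st x} → st x ≡ black → x ∈ blackSet st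
  black⇒∈blackSet {st} {x} eq = lookup⇒[]= x (blackSet st) (trans (lookup-blackSet st x) (cong isBlack eq))

  white⇒∉blackSet : ∀ {st x m} → st x ≡ white m → x ∉ blackSet st
  white⇒∉blackSet {st} {x} eq x∈
    with trans (≡-sym ([]=⇒lookup x∈)) (trans (lookup-blackSet st x) (cong isBlack eq))
  ... | ()

  blackSet-cong : ∀ {st st'} → st ≗ st' → blackSet st ≡ blackSet st'
  blackSet-cong eq = tabulate-cong (cong isBlack ∘ eq)

  blackSet-initState : ∀ S → blackSet (initState S) ≡ S
  blackSet-initState S = Pointwise-≡⇒≡ (ext λ x → trans (lookup-blackSet (initState S) x) (initial x))
    where
      initial : ∀ x → isBlack (initState S x) ≡ lookup S x
      initial x with lookup S x
      ... | true = refl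
      ... | false = refl

  blackSet-blacken : ∀ st w → blackSet (update st w black) ≡ blackSet st [ w ]≔ true
  blackSet-blacken st w = Pointwise-≡⇒≡ (ext λ x → trans (lookup-blackSet (update st w black) x) (pointwise x))
    where
      pointwise : ∀ x → isBlack (update st w black x) ≡ lookup (blackSet st [ w ]≔ true) x
      pointwise x with x ≟ w
      ... | yes refl = ≡-sym (lookup∘update x (blackSet st) true)
      ... | no x≢w = trans (≡-sym (lookup-blackSet st x)) (≡-sym (lookup∘update′ x≢w (blackSet st) true))

  blackSet-mark : ∀ {st w m} m' → st w ≡ white m → blackSet (update st w (white m')) ≡ blackSet st
  blackSet-mark {st} {w} m' eq = tabulate-cong pointwise
    where
      pointwise : ∀ x → isBlack (update st w (white m') x) ≡ isBlack (st x)
      pointwise x with x ≟ w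
      ... | yes refl = ≡-sym (cong isBlack eq)
      ... | no _ = refl

  initState-∈ : ∀ {S : Subset n} {x} → x ∈ S → initState S x ≡ black
  initState-∈ {S} {x} x∈S rewrite []=⇒lookup x∈S = refl

  initState-∉ : ∀ {S : Subset n} {x} → x ∉ S → initState S x ≡ white unmarked
  initState-∉ {S} {x} x∉S with lookup S x in eq
  ... | true = ⊥-elim (x∉S (lookup⇒[]= x S eq))
  ... | false = refl

  initState-add : ∀ (S : Subset n) w → update (initState S) w black ≗ initState (S [ w ]≔ true)
  initState-add S w x with x ≟ w
  ... | yes refl = ≡-sym (initState-∈ {S [ x ]≔ true} (lookup⇒[]= x _ (lookup∘update x S true)))
  ... | no x≢w rewrite lookup∘update′ x≢w S true = refl

module _ {n : ℕ} (G : Graph n) where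

  open import Data.List.Membership.DecPropositional (_≟_ {n}) using (_∈?_)

  _~_ : Fin n → Fin n → Set
  u ~ v = u ∼[ G ] v

  ~-sym : ∀ {u v} → u ~ v → v ~ u
  ~-sym {u} {v} = subst T (Graph.sym G u v)

  ~-irrefl : ∀ {u} → ¬ u ~ u
  ~-irrefl {u} = subst T (irrefl G u)

  data WalkIn (Q : Fin n → Set) : Fin n → Fin n → Set where
    nil  : ∀ {u} → Q u → WalkIn Q u u
    cons : ∀ {u w v} → Q u → u ~ w → WalkIn Q w v → WalkIn Q u v

  vertices : ∀ {Q u v} → WalkIn Q u v → List (Fin n)
  vertices (nil {u} _) = [ u ]
  vertices (cons {u} _ _ q) = u ∷ vertices q

  mapWalk : ∀ {Q R : Fin n → Set} → (∀ {x} → Q x → R x) → ∀ {u v} → WalkIn Q u v → WalkIn R u v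
  mapWalk f (nil qu) = nil (f qu)
  mapWalk f (cons qu e q) = cons (f qu) e (mapWalk f q)

  _++ʷ_ : ∀ {Q u v w} → WalkIn Q u v → WalkIn Q v w → WalkIn Q u w
  nil _ ++ʷ r = r
  cons qu e q ++ʷ r = cons qu e (q ++ʷ r)

  start : ∀ {Q u v} → WalkIn Q u v → Q u
  start (nil qu) = qu
  start (cons qu _ _) = qu

  reverseWalk : ∀ {Q u v} → WalkIn Q u v → WalkIn Q v u
  reverseWalk (nil qu) = nil qu
  reverseWalk (cons qu e q) = reverseWalk q ++ʷ cons (start q) (~-sym e) (nil qu)

  all-vertices : ∀ {Q u v} (q : WalkIn Q u v) → All Q (vertices q)
  all-vertices (nil qu) = qu ∷ []
  all-vertices (cons qu _ q) = qu ∷ all-vertices q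

  dropUntil : ∀ {Q w v} u (q : WalkIn Q w v) → u ∈ₗ vertices q → WalkIn Q u v
  dropUntil u q@(nil _) (here refl) = q
  dropUntil u q@(cons _ _ _) (here refl) = q
  dropUntil u (cons _ _ q) (there u∈q) = dropUntil u q u∈q

  dropUntil-unique : ∀ {Q w v} u (q : WalkIn Q w v) (u∈q : u ∈ₗ vertices q) →
                     Unique (vertices q) → Unique (vertices (dropUntil u q u∈q))
  dropUntil-unique u (nil _) (here refl) uq = uq
  dropUntil-unique u (cons _ _ _) (here refl) uq = uq
  dropUntil-unique u (cons _ _ q) (there u∈q) (_ ∷ uq) = dropUntil-unique u q u∈q uq

  toPath : ∀ {Q u v} → WalkIn Q u v → Σ (WalkIn Q u v) (Unique ∘ vertices)
  toPath (nil qu) = nil qu , [] ∷ []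
  toPath (cons {u} qu e q) with toPath q
  ... | p , up with u ∈? vertices p
  ...   | yes u∈p = dropUntil u p u∈p , dropUntil-unique u p u∈p up
  ...   | no u∉p = cons qu e p , ¬Any⇒All¬ (vertices p) u∉p ∷ up

  linked-around : ∀ {Q a u v c} → a ~ u → (q : WalkIn Q u v) → v ~ c → Linked _~_ (a ∷ vertices q ++ [ c ])
  linked-around a~u (nil _) v~c = a~u ∷ v~c ∷ [-]
  linked-around a~u (cons _ e q) v~c = a~u ∷ linked-around e q v~c

  2≤length-vertices : ∀ {Q u v} (q : WalkIn Q u v) → u ≢ v → 2 ≤ length (vertices q)
  2≤length-vertices (nil _) u≢u = ⊥-elim (u≢u refl)
  2≤length-vertices (cons _ _ (nil _)) _ = s≤s (s≤s z≤n)
  2≤length-vertices (cons _ _ (cons _ _ _)) _ = s≤s (s≤s z≤n)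

  acyclic⇒¬walk-avoiding : Acyclic G → ∀ {a a' b} → a ~ a' → b ~ a → a' ≢ b → ¬ WalkIn (a ≢_) a' b
  acyclic⇒¬walk-avoiding acyclic {a} a~a' b~a a'≢b q with toPath q
  ... | p , up =
    acyclic a (vertices p) (2≤length-vertices p a'≢b , all-vertices p ∷ up , linked-around a~a' p b~a)

  PZ-diagonal : ∀ u → PZ G u u ≡ ques
  PZ-diagonal u with u ≟ u
  ... | yes _ = refl
  ... | no u≢u = ⊥-elim (u≢u refl)

  PZ-sgn⇒adjacent : ∀ u x {p} → PZ G u x ≡ sgn p → u ~ x × p ≡ neg
  PZ-sgn⇒adjacent u x eq with u ≟ x | adj G u x
  PZ-sgn⇒adjacent u x () | yes _ | _
  PZ-sgn⇒adjacent u x refl | no _ | true = _ , refl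
  PZ-sgn⇒adjacent u x () | no _ | false

  PZ-adjacent : ∀ u x → u ~ x → PZ G u x ≡ sgn neg
  PZ-adjacent u x e with u ≟ x
  ... | yes refl = ⊥-elim (~-irrefl e)
  ... | no _ with adj G u x
  ...   | true = refl
  ...   | false = ⊥-elim e

  active⇒black : ∀ st u → Active (PZ G) st u → st u ≡ black
  active⇒black _ _ (inj₁ ub) = ub
  active⇒black _ u (inj₂ (_ , not-ques)) = ⊥-elim (not-ques (PZ-diagonal u))

  white-neighbour∈W : ∀ st u x {m} → u ~ x → st x ≡ white m → InWany (PZ G) st u x
  white-neighbour∈W st u x u~x wx = _ , neg , wx , PZ-adjacent u x u~x

  unique-W⇒ZFStep : ∀ st u w → st u ≡ black → InWany (PZ G) st u w →
                    (∀ x → InWany (PZ G) st u x → x ≡ w) →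
                    ZFStep G (blackSet st) (blackSet (update st w black))
  unique-W⇒ZFStep st u w ub (_ , _ , wx , uw) unique =
    subst (ZFStep G (blackSet st)) (≡-sym (blackSet-blacken st w))
      (force u w (black⇒∈blackSet ub) (white⇒∉blackSet wx) (proj₁ (PZ-sgn⇒adjacent u w uw)) others)
    where
      others : ∀ x → u ~ x → x ≢ w → x ∈ blackSet st
      others x u~x x≢w with st x in sx
      ... | black = black⇒∈blackSet sx
      ... | white _ = ⊥-elim (x≢w (unique x (white-neighbour∈W st u x u~x sx)))

  record Invariant (st : State n) : Set where
    field
      marks-connected   : ∀ {x y p q} → Marked st x p → Marked st y q → WalkIn (Touched st) x y
      marks-nonadjacent : ∀ {x y p q} → x ~ y → Marked st x p → ¬ Marked st y q
      no-twin-marks     : ∀ {v z z' p} → st v ≡ black → v ~ z → v ~ z' → z ≢ z' →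
                          Marked st z p → ¬ Marked st z' p
  open Invariant

  Invariant-cong : ∀ {st st'} → st ≗ st' → Invariant st → Invariant st'
  Invariant-cong {st} {st'} eq I = record
    { marks-connected   = λ mx my →
        mapWalk (λ {x} tx → tx ∘ trans (eq x)) (marks-connected I (back mx) (back my))
    ; marks-nonadjacent = λ e mx my → marks-nonadjacent I e (back mx) (back my)
    ; no-twin-marks     = λ {v} vb e e' z≢z' mz mz' →
        no-twin-marks I (trans (eq v) vb) e e' z≢z' (back mz) (back mz') }
    where
      back : ∀ {x p} → Marked st' x p → Marked st x p
      back {x} = trans (eq x)

  Invariant-initState : ∀ S → Invariant (initState S)
  Invariant-initState S = record
    { marks-connected   = λ mx _ → ⊥-elim (unmarked-initially mx)
    ; marks-nonadjacent = λ _ mx _ → unmarked-initially mx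
    ; no-twin-marks     = λ _ _ _ _ mz _ → unmarked-initially mz }
    where
      unmarked-initially : ∀ {x p} → ¬ Marked (initState S) x p
      unmarked-initially {x} mx with lookup S x
      unmarked-initially () | true
      unmarked-initially () | false

  Invariant-blacken : Acyclic G → ∀ {st w m} → Invariant st → st w ≡ white m → Invariant (update st w black)
  Invariant-blacken acyclic {st} {w} {m} I wx = record
    { marks-connected   = λ mx my → mapWalk (touched-update st w λ ()) (marks-connected I (old mx) (old my))
    ; marks-nonadjacent = λ e mx my → marks-nonadjacent I e (old mx) (old my)
    ; no-twin-marks     = no-twins }
    where
      old : ∀ {x p} → Marked (update st w black) x p → Marked st x p
      old = marked-after-blackening {st = st} {w = w}

      no-twins : ∀ {v z z' p} → update st w black v ≡ black → v ~ z → v ~ z' → z ≢ z' →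
                 Marked (update st w black) z p → ¬ Marked (update st w black) z' p
      no-twins {v} vb e e' z≢z' mz mz' with v ≟ w
      ... | no _ = no-twin-marks I vb e e' z≢z' (old mz) (old mz')
      ... | yes refl = was-white m wx
        where
          was-white : ∀ m → ¬ st w ≡ white m
          was-white (marked _) mw = marks-nonadjacent I e mw (old mz)
          was-white unmarked fw = acyclic⇒¬walk-avoiding acyclic e (~-sym e') z≢z'
            (mapWalk (fresh-avoids-touched fw) (marks-connected I (old mz) (old mz')))

  -- Move (c) in P_Z(G): x ∈ W_s(u) forces t = m(x) = ι s, and w receives P_uw · ι s = ι t.
  module MoveC (acyclic : Acyclic G) {st u x w t} (I : Invariant st) (ub : st u ≡ black)
               (u~x : u ~ x) (mx : Marked st x t) (u~w : u ~ w) (fw : Fresh st w)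
               (no-opposite : ∀ {y} → u ~ y → ¬ Marked st y (ι t)) where

    st' : State n
    st' = update st w (white (marked (ι t)))

    new-or-old : ∀ {y q} → Marked st' y q → (y ≡ w × q ≡ ι t) ⊎ (y ≢ w × Marked st y q)
    new-or-old = marked-after-marking {st = st} {w = w}

    touched' : ∀ {y} → Touched st y → Touched st' y
    touched' = touched-update st w λ ()

    w-touched' : Touched st' w
    w-touched' f with trans (≡-sym (update-≡ st w _)) f
    ... | ()

    walk-from-u : ∀ {y q} → Marked st y q → WalkIn (Touched st) u y
    walk-from-u my = cons (black-touched {st = st} ub) u~x (marks-connected I mx my)

    walk-from-w : ∀ {y q} → Marked st y q → WalkIn (Touched st') w y
    walk-from-w my = cons w-touched' (~-sym u~w) (mapWalk touched' (walk-from-u my))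

    u≢marked : ∀ {y q} → Marked st y q → u ≢ y
    u≢marked my refl with trans (≡-sym ub) my
    ... | ()

    w≁marked : ∀ {y q} → w ~ y → ¬ Marked st y q
    w≁marked w~y my = acyclic⇒¬walk-avoiding acyclic (~-sym u~w) (~-sym w~y) (u≢marked my)
      (mapWalk (fresh-avoids-touched fw) (walk-from-u my))

    opposite≁black~w : ∀ {v z} → st v ≡ black → v ~ w → v ~ z → ¬ Marked st z (ι t)
    opposite≁black~w {v} vb v~w v~z mz with v ≟ u
    ... | yes refl = no-opposite v~z mz
    ... | no v≢u = acyclic⇒¬walk-avoiding acyclic (~-sym u~w) v~w (v≢u ∘ ≡-sym)
      (mapWalk (fresh-avoids-touched fw)
        (walk-from-u mz ++ʷ cons (marked-touched {st = st} mz) (~-sym v~z)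
                                  (nil (black-touched {st = st} vb))))

    connected : ∀ {y y' p q} → Marked st' y p → Marked st' y' q → WalkIn (Touched st') y y'
    connected m m' with new-or-old m | new-or-old m'
    ... | inj₁ (refl , _) | inj₁ (refl , _) = nil w-touched'
    ... | inj₁ (refl , _) | inj₂ (_ , m₂)   = walk-from-w m₂
    ... | inj₂ (_ , m₁)   | inj₁ (refl , _) = reverseWalk (walk-from-w m₁)
    ... | inj₂ (_ , m₁)   | inj₂ (_ , m₂)   = mapWalk touched' (marks-connected I m₁ m₂)

    nonadjacent : ∀ {y y' p q} → y ~ y' → Marked st' y p → ¬ Marked st' y' q
    nonadjacent e m m' with new-or-old m | new-or-old m'
    ... | inj₁ (refl , _) | inj₁ (refl , _) = ~-irrefl e
    ... | inj₁ (refl , _) | inj₂ (_ , m₂)   = w≁marked e m₂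
    ... | inj₂ (_ , m₁)   | inj₁ (refl , _) = w≁marked (~-sym e) m₁
    ... | inj₂ (_ , m₁)   | inj₂ (_ , m₂)   = marks-nonadjacent I e m₁ m₂

    no-twins : ∀ {v z z' p} → st' v ≡ black → v ~ z → v ~ z' → z ≢ z' →
               Marked st' z p → ¬ Marked st' z' p
    no-twins {v} vb e e' z≢z' m m' with v ≟ w
    no-twins () e e' z≢z' m m' | yes refl
    ... | no _ with new-or-old m | new-or-old m'
    ...   | inj₁ (refl , _)    | inj₁ (refl , _)    = z≢z' refl
    ...   | inj₁ (refl , refl) | inj₂ (_ , m₂)      = opposite≁black~w vb e e' m₂
    ...   | inj₂ (_ , m₁)      | inj₁ (refl , refl) = opposite≁black~w vb e' e m₁
    ...   | inj₂ (_ , m₁)      | inj₂ (_ , m₂)      = no-twin-marks I vb e e' z≢z' m₁ m₂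

    invariant : Invariant st'
    invariant = record
      { marks-connected = connected ; marks-nonadjacent = nonadjacent ; no-twin-marks = no-twins }

  Invariant-first-mark : ∀ {st r} → (∀ x p → st x ≢ white (marked p)) →
                         Invariant (update st r (white (marked pos)))
  Invariant-first-mark {st} {r} no-marks = record
    { marks-connected   = λ m m' → connected (only-r m) (only-r m') m
    ; marks-nonadjacent = λ e m m' → nonadjacent (only-r m) (only-r m') e
    ; no-twin-marks     = λ _ _ _ z≢z' m m' → z≢z' (trans (only-r m) (≡-sym (only-r m'))) }
    where
      st' : State n
      st' = update st r (white (marked pos))

      only-r : ∀ {y q} → Marked st' y q → y ≡ r
      only-r m with marked-after-marking {st = st} {w = r} m
      ... | inj₁ (y≡r , _) = y≡r
      ... | inj₂ (_ , m-old) = ⊥-elim (no-marks _ _ m-old)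

      connected : ∀ {y y' q} → y ≡ r → y' ≡ r → Marked st' y q → WalkIn (Touched st') y y'
      connected refl refl m = nil (marked-touched {st = st'} m)

      nonadjacent : ∀ {y y'} → y ≡ r → y' ≡ r → ¬ y ~ y'
      nonadjacent refl refl = ~-irrefl

  equal-marks⇒W-subsingleton : ∀ {st u s} → Invariant st → st u ≡ black →
                               (∀ x → InWany (PZ G) st u x → InWs (PZ G) st u s x) →
                               ∀ {x y} → InWany (PZ G) st u x → InWany (PZ G) st u y → x ≡ y
  equal-marks⇒W-subsingleton {st} {u} I ub all-Ws {x} {y} x∈W y∈W with x ≟ y
  ... | yes x≡y = x≡y
  ... | no x≢y with all-Ws x x∈W | all-Ws y y∈W
  ... | (p , _ , (mx , ux) , px) | (q , _ , (my , uy) , qy)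
    with PZ-sgn⇒adjacent u x ux | PZ-sgn⇒adjacent u y uy
  ... | (u~x , refl) | (u~y , refl) =
    ⊥-elim (no-twin-marks I ub u~x u~y x≢y mx (subst (Marked st y) (·neg-injective qy px) my))

  simulate : Acyclic G → ∀ {st st'} → Invariant st → SMove (PZ G) st st' →
             Invariant st' × Star (ZFStep G) (blackSet st) (blackSet st')
  simulate acyclic {st} I (ruleA u w act unique w∈W@(_ , _ , wx , _)) =
    Invariant-blacken acyclic I wx , unique-W⇒ZFStep st u w (active⇒black st u act) w∈W unique ◅ ε
  simulate acyclic {st} I (ruleB u s act all-Ws st' on-W off-W) with any? (W? (PZ G) st u)
  ... | no W-empty = Invariant-cong unchanged I , reflexive (ZFStep G) (blackSet-cong unchanged)
    where
      unchanged : st ≗ st'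
      unchanged x = ≡-sym (off-W x λ x∈W → W-empty (x , x∈W))
  ... | yes (w , w∈W@(_ , _ , wx , _)) =
    Invariant-cong blackened (Invariant-blacken acyclic I wx) ,
    unique-W⇒ZFStep st u w ub w∈W unique ◅ reflexive (ZFStep G) (blackSet-cong blackened)
    where
      ub : st u ≡ black
      ub = active⇒black st u act
      unique : ∀ x → InWany (PZ G) st u x → x ≡ w
      unique x x∈W = equal-marks⇒W-subsingleton I ub all-Ws x∈W w∈W
      blackened : update st w black ≗ st'
      blackened x with x ≟ w
      ... | yes refl = ≡-sym (on-W x w∈W)
      ... | no x≢w = ≡-sym (off-W x (x≢w ∘ unique x))
  simulate acyclic {st} I (ruleC u s w _ act (x , p , _ , (mx , ux) , px) no-ι-s _ (fw , uw))
    with PZ-sgn⇒adjacent u x ux | PZ-sgn⇒adjacent u w uw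
  ... | (u~x , refl) | (u~w , refl) =
    subst (λ q → Invariant (update st w (white (marked q)))) (≡-sym (proj₂ signs))
      (MoveC.invariant acyclic I (active⇒black st u act) u~x mx u~w fw no-opposite) ,
    reflexive (ZFStep G) (≡-sym (blackSet-mark _ fw))
    where
      signs : ι p · neg ≡ ι s × neg · ι s ≡ ι p
      signs = ι-·neg px
      no-opposite : ∀ {y} → u ~ y → ¬ Marked st y (ι p)
      no-opposite u~y my = no-ι-s _ (ι p , neg , (my , PZ-adjacent u _ u~y) , proj₁ signs)
  simulate _ I (ruleD w no-marks fw) =
    Invariant-first-mark no-marks , reflexive (ZFStep G) (≡-sym (blackSet-mark _ fw))

  simulate* : Acyclic G → ∀ {st st'} → Invariant st → Star (SMove (PZ G)) st st' →
              Star (ZFStep G) (blackSet st) (blackSet st')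
  simulate* acyclic I ε = ε
  simulate* acyclic I (move ◅ moves) with simulate acyclic I move
  ... | I' , forces = forces ◅◅ simulate* acyclic I' moves

  signed⇒classical : Acyclic G → ∀ {S} → IsSZFSet (PZ G) S → IsZFSet G S
  signed⇒classical acyclic {S} (st , moves , all-black) =
    blackSet st ,
    subst (λ B → Star (ZFStep G) B (blackSet st)) (blackSet-initState S)
      (simulate* acyclic (Invariant-initState S) moves) ,
    λ x → black⇒∈blackSet (all-black x)

  force⇒ruleA : ∀ {B B' st} → st ≗ initState B → ZFStep G B B' →
                ∃ λ st' → SMove (PZ G) st st' × st' ≗ initState B'
  force⇒ruleA {B} {st = st} st≗B (force u w u∈B w∉B u~w others) =
    update st w black ,
    ruleA u w (inj₁ (trans (st≗B u) (initState-∈ u∈B))) unique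
          (white-neighbour∈W st u w u~w (trans (st≗B w) (initState-∉ w∉B))) ,
    λ x → trans (cong-update x) (initState-add B w x)
    where
      unique : ∀ x → InWany (PZ G) st u x → x ≡ w
      unique x (_ , _ , wx , ux) with x ≟ w
      ... | yes x≡w = x≡w
      ... | no x≢w with trans (≡-sym wx) (trans (st≗B x)
                          (initState-∈ (others x (proj₁ (PZ-sgn⇒adjacent u x ux)) x≢w)))
      ...   | ()
      cong-update : update st w black ≗ update (initState B) w black
      cong-update x with x ≟ w
      ... | yes _ = refl
      ... | no _ = st≗B x

  classical⇒signed* : ∀ {B B' st} → st ≗ initState B → Star (ZFStep G) B B' → AllBlack B' →
                      ∃ λ st' → Star (SMove (PZ G)) st st' × (∀ x → st' x ≡ black)
  classical⇒signed* {st = st} st≗B ε all-black =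
    st , ε , λ x → trans (st≗B x) (initState-∈ (all-black x))
  classical⇒signed* st≗B (f ◅ fs) all-black with force⇒ruleA st≗B f
  ... | st₁ , move , st₁≗B₁ with classical⇒signed* st₁≗B₁ fs all-black
  ...   | st' , moves , done = st' , move ◅ moves , done

  classical⇒signed : ∀ {S} → IsZFSet G S → IsSZFSet (PZ G) S
  classical⇒signed (_ , forces , all-black) = classical⇒signed* (λ _ → refl) forces all-black

mainTheorem4 : ∀ {n} (T : Graph n) → IsTree T →
    ∀ k m → IsZ T k → IsZpm (PZ T) m → k ≡ m
mainTheorem4 T (_ , acyclic) k m ((S , S-forces , ∣S∣≡k) , k-minimal)
                                 ((S± , S±-forces , ∣S±∣≡m) , m-minimal) =
  ≤-antisym (subst (k ≤_) ∣S±∣≡m (k-minimal S± (signed⇒classical T acyclic S±-forces)))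
            (subst (m ≤_) ∣S∣≡k (m-minimal S (classical⇒signed T S-forces)))
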